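{- Suppose that for all positive integers $a,c$ with $c<a\le 2c$ a $\mathrm{LC}(a^2c^1)$ exists. Then for all integers $n\ge4$ and positive integers $a,b$ with $(n-2)b<a\le 2(n-2)b$, a $\mathrm{LC}(a^2b^{n-2})$ exists.
   Context: A latin cube of order $N$ is an $N\times N\times N$ array on $N$ symbols such that any two cells whose coordinates differ in exactly one position contain different symbols; a subcube is an $m\times m\times m$ subarray (indices in each coordinate from chosen $m$-sets) that is itself a latin cube of order $m$; subcubes are disjoint if they share no index in any coordinate and no symbol. $\mathrm{LC}(a^2c^1)$ denotes a latin cube of order $2a+c$ with pairwise disjoint subcubes of orders $a,a,c$; $\mathrm{LC}(a^2b^{n-2})$ denotes a latin cube of order $2a+(n-2)b$ with pairwise disjoint subcubes, two of order $a$ and $n-2$ of order $b$. -}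

module Defs where

open import Data.Nat using (ℕ; _+_)
open import Data.Fin using (Fin)
open import Data.List using (List; length; lookup)
open import Data.Nat.ListAction using (sum)
open import Data.Product using (Σ; _×_)
open import Relation.Binary.PropositionalEquality using (_≡_; _≢_)
open import Function.Definitions using (Injective)

Array3 : ℕ → Set
Array3 N = Fin N → Fin N → Fin N → Fin N

IsLatinCube : (N : ℕ) → Array3 N → Set
IsLatinCube N L =
  (∀ i i′ j k → i ≢ i′ → L i j k ≢ L i′ j k) ×
  (∀ i j j′ k → j ≢ j′ → L i j k ≢ L i j′ k) ×
  (∀ i j k k′ → k ≢ k′ → L i j k ≢ L i j k′)

record Subcube {N : ℕ} (L : Array3 N) (m : ℕ) : Set where
  field
    rows    : Fin m → Fin N
    cols    : Fin m → Fin N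
    files   : Fin m → Fin N
    symbols : Fin m → Fin N
    rows-inj    : Injective _≡_ _≡_ rows
    cols-inj    : Injective _≡_ _≡_ cols
    files-inj   : Injective _≡_ _≡_ files
    symbols-inj : Injective _≡_ _≡_ symbols
    sub       : Array3 m
    sub-latin : IsLatinCube m sub
    sub-agrees : ∀ i j k → L (rows i) (cols j) (files k) ≡ symbols (sub i j k)
open Subcube public

DisjointImages : {m m′ N : ℕ} → (Fin m → Fin N) → (Fin m′ → Fin N) → Set
DisjointImages f g = ∀ i j → f i ≢ g j

Disjoint : {N m m′ : ℕ} {L : Array3 N} → Subcube L m → Subcube L m′ → Set
Disjoint S T =
  DisjointImages (rows S) (rows T) ×
  DisjointImages (cols S) (cols T) ×
  DisjointImages (files S) (files T) ×
  DisjointImages (symbols S) (symbols T)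

LC : List ℕ → Set
LC orders =
  Σ (Array3 (sum orders)) λ L →
    IsLatinCube (sum orders) L ×
    Σ ((t : Fin (length orders)) → Subcube L (lookup orders t)) λ S →
      ∀ t u → t ≢ u → Disjoint (S t) (S u)

-- Replace the subcube of order c = (n-2)b in an LC(a²c¹) by another latin
-- cube on the same rows, columns, files and symbols; as every line of the
-- subcube already carries exactly the subcube's symbols, the whole array
-- stays latin, and the two subcubes of order a are untouched.  The
-- replacement is the direct product of the cyclic latin cube of order n-2
-- with the cyclic one of order b.  The cells (t, t, -1-t) of the cyclic
-- cube differ pairwise in every coordinate and in the symbol t - 1, so their
-- products with the factor of order b are n-2 disjoint subcubes of order b.
module Submission where

open import Defs
open import Data.Nat using (ℕ; _+_; _*_; _∸_; _≤_; _<_)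
open import Data.List using (List; _∷_; []; replicate)

open import Data.Nat using (zero; suc; s≤s; z≤n; _%_; NonZero)
import Data.Nat.Properties as ℕ
open import Data.Nat.DivMod using (_mod_; %-distribˡ-+; m%n%n≡m%n; [m+kn]%n≡m%n; m<n⇒m%n≡m)
open import Data.Nat.ListAction using (sum)
open import Algebra.Properties.CommutativeSemigroup ℕ.+-commutativeSemigroup
  using (x∙yz≈y∙xz; x∙yz≈z∙xy)
open import Data.Fin using (Fin; zero; suc; toℕ; combine; remQuot; opposite; punchOut)
open import Data.Fin.Properties
  using (_≟_; any?; toℕ-injective; toℕ<n; toℕ≤pred[n]; toℕ-fromℕ<; suc-injective; <⇒≢;
         pigeonhole; punchOut-injective; combine-injective; combine-injectiveˡ;
         combine-injectiveʳ; combine-remQuot; remQuot-combine; opposite-prop;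
         opposite-involutive)
open import Data.List using (length; lookup)
open import Data.Product using (Σ; ∃; _×_; _,_; proj₁; proj₂; map₂; uncurry)
open import Data.Product.Properties using (×-≡,≡→≡)
open import Data.Empty using (⊥-elim)
open import Relation.Nullary using (Dec; yes; no; ¬_)
open import Relation.Nullary.Decidable using (_×-dec_; decidable-stable)
open import Relation.Binary.PropositionalEquality
open import Function using (_∘_)
open import Function.Definitions using (Injective)
open import Function.Construct.Composition using () renaming (injective to ∘-injective)

private
  variable
    m n p N : ℕ
    A : Set

≢-preserving⇒injective : {f : Fin n → A} → (∀ x y → x ≢ y → f x ≢ f y) → Injective _≡_ _≡_ f
≢-preserving⇒injective preserves {x} {y} e = decidable-stable (x ≟ y) (λ x≢y → preserves x y x≢y e)

injective-resp-≗ : {f g : Fin n → A} → g ≗ f → Injective _≡_ _≡_ f → Injective _≡_ _≡_ g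
injective-resp-≗ g≗f f-inj e = f-inj (trans (sym (g≗f _)) (trans e (g≗f _)))

injective⇒surjective : {f : Fin n → Fin n} → Injective _≡_ _≡_ f → ∀ y → ∃ λ x → f x ≡ y
injective⇒surjective {zero} _ ()
injective⇒surjective {suc n} {f} f-inj y with any? (λ x → f x ≟ y)
... | yes hit = hit
... | no miss =
  let i , j , i<j , eq = pigeonhole (ℕ.n<1+n n) (λ x → punchOut (avoids x))
  in ⊥-elim (<⇒≢ i<j (f-inj (punchOut-injective (avoids i) (avoids j) eq)))
  where
  avoids : ∀ x → y ≢ f x
  avoids x e = miss (x , sym e)

preimage? : (f : Fin m → Fin N) (i : Fin N) → Dec (∃ λ r → f r ≡ i)
preimage? f i = any? (λ r → f r ≟ i)

module _ {g g′ : Fin N → A} (R : Fin m → Fin N)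
         (g-inj : Injective _≡_ _≡_ g) (g′∘R-inj : Injective _≡_ _≡_ (g′ ∘ R))
         (absorbed : ∀ r → ∃ λ r₀ → g′ (R r) ≡ g (R r₀))
         (unchanged : ∀ i → ¬ (∃ λ r → R r ≡ i) → g′ i ≡ g i) where

  private
    image-apart : ∀ r {i} → ¬ (∃ λ r → R r ≡ i) → g′ (R r) ≢ g′ i
    image-apart r {i} outside e =
      let r₀ , e₀ = absorbed r
      in outside (r₀ , g-inj (trans (sym e₀) (trans e (unchanged i outside))))

  patch-injective : Injective _≡_ _≡_ g′
  patch-injective {i} {i′} e with preimage? R i | preimage? R i′
  ... | yes (r , refl) | yes (r′ , refl) = cong R (g′∘R-inj e)
  ... | yes (r , refl) | no outside′     = ⊥-elim (image-apart r outside′ e)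
  ... | no outside     | yes (r′ , refl) = ⊥-elim (image-apart r′ outside (sym e))
  ... | no outside     | no outside′     =
    g-inj (trans (sym (unchanged i outside)) (trans e (unchanged i′ outside′)))

module _ {L : Array3 N} (L-latin : IsLatinCube N L) where

  latin₁ : ∀ j k → Injective _≡_ _≡_ (λ i → L i j k)
  latin₁ j k = ≢-preserving⇒injective (λ i i′ → proj₁ L-latin i i′ j k)

  latin₂ : ∀ i k → Injective _≡_ _≡_ (λ j → L i j k)
  latin₂ i k = ≢-preserving⇒injective (λ j j′ → proj₁ (proj₂ L-latin) i j j′ k)

  latin₃ : ∀ i j → Injective _≡_ _≡_ (λ k → L i j k)
  latin₃ i j = ≢-preserving⇒injective (λ k k′ → proj₂ (proj₂ L-latin) i j k k′)

injective-lines⇒latin : {L : Array3 N} →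
  (∀ j k → Injective _≡_ _≡_ (λ i → L i j k)) →
  (∀ i k → Injective _≡_ _≡_ (λ j → L i j k)) →
  (∀ i j → Injective _≡_ _≡_ (λ k → L i j k)) →
  IsLatinCube N L
injective-lines⇒latin inj₁ inj₂ inj₃ =
  (λ i i′ j k i≢i′ → i≢i′ ∘ inj₁ j k) ,
  (λ i j j′ k j≢j′ → j≢j′ ∘ inj₂ i k) ,
  (λ i j k k′ k≢k′ → k≢k′ ∘ inj₃ i j)

DisjointImages-sym : {f : Fin m → Fin N} {g : Fin n → Fin N} →
  DisjointImages f g → DisjointImages g f
DisjointImages-sym apart x y = apart y x ∘ sym

Disjoint-sym : {L : Array3 N} (S : Subcube L m) (T : Subcube L n) → Disjoint S T → Disjoint T S
Disjoint-sym _ _ (r , c , f , s) =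
  DisjointImages-sym r , DisjointImages-sym c , DisjointImages-sym f , DisjointImages-sym s

+-%-cancelʳ : .{{_ : NonZero n}} → ∀ c {x x′} → x < n → x′ < n →
  (x + c) % n ≡ (x′ + c) % n → x ≡ x′
+-%-cancelʳ {n} c {x} {x′} x<n x′<n e =
  trans (sym (subtract-c x x<n)) (trans (cong (λ w → (w + c′) % n) e) (subtract-c x′ x′<n))
  where
  c′ = c * n ∸ c
  -- adding c′ undoes adding c, since c + c′ = c * n.
  subtract-c : ∀ y → y < n → ((y + c) % n + c′) % n ≡ y
  subtract-c y y<n = begin
    ((y + c) % n + c′) % n          ≡⟨ %-distribˡ-+ ((y + c) % n) c′ n ⟩
    ((y + c) % n % n + c′ % n) % n  ≡⟨ cong (λ w → (w + c′ % n) % n) (m%n%n≡m%n (y + c) n) ⟩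
    ((y + c) % n + c′ % n) % n      ≡⟨ %-distribˡ-+ (y + c) c′ n ⟨
    (y + c + c′) % n                ≡⟨ cong (_% n) (ℕ.+-assoc y c c′) ⟩
    (y + (c + c′)) % n              ≡⟨ cong (λ w → (y + w) % n) (ℕ.m+[n∸m]≡n (ℕ.m≤m*n c n)) ⟩
    (y + c * n) % n                 ≡⟨ [m+kn]%n≡m%n y c n ⟩
    y % n                           ≡⟨ m<n⇒m%n≡m y<n ⟩
    y                               ∎
    where open ≡-Reasoning

mod-cancelʳ : .{{_ : NonZero n}} → ∀ c {x x′ : Fin n} →
  (toℕ x + c) mod n ≡ (toℕ x′ + c) mod n → x ≡ x′
mod-cancelʳ c {x} {x′} e = toℕ-injective (+-%-cancelʳ c (toℕ<n x) (toℕ<n x′)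
  (trans (sym (toℕ-fromℕ< _)) (trans (cong toℕ e) (toℕ-fromℕ< _))))

cyclic : ∀ m → Array3 (suc m)
cyclic m x y z = (toℕ x + (toℕ y + toℕ z)) mod suc m

cyclic-latin : ∀ m → IsLatinCube (suc m) (cyclic m)
cyclic-latin m = injective-lines⇒latin
  (λ y z → mod-cancelʳ (toℕ y + toℕ z))
  (λ x z {y} {y′} → mod-cancelʳ (toℕ x + toℕ z) ∘ rotate (λ w → x∙yz≈y∙xz (toℕ x) w (toℕ z)) y y′)
  (λ x y {z} {z′} → mod-cancelʳ (toℕ x + toℕ y) ∘ rotate (x∙yz≈z∙xy (toℕ x) (toℕ y)) z z′)
  where
  rotate : ∀ {f g : ℕ → ℕ} → f ≗ g → ∀ (u v : Fin (suc m)) →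
    f (toℕ u) mod suc m ≡ f (toℕ v) mod suc m → g (toℕ u) mod suc m ≡ g (toℕ v) mod suc m
  rotate f≗g u v e = trans (cong (_mod suc m) (sym (f≗g (toℕ u)))) (trans e (cong (_mod suc m) (f≗g (toℕ v))))

opposite-injective : Injective _≡_ _≡_ (opposite {n})
opposite-injective {x = x} {y} e =
  trans (sym (opposite-involutive x)) (trans (cong opposite e) (opposite-involutive y))

cyclic-diagonal-injective : ∀ m → Injective _≡_ _≡_ (λ t → cyclic m t t (opposite t))
cyclic-diagonal-injective m {t} {u} e = mod-cancelʳ m (trans (sym (diagonal t)) (trans e (diagonal u)))
  where
  diagonal : ∀ t → cyclic m t t (opposite t) ≡ (toℕ t + m) mod suc m
  diagonal t = cong (λ w → (toℕ t + w) mod suc m)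
    (trans (cong (toℕ t +_) (opposite-prop t)) (ℕ.m+[n∸m]≡n (toℕ≤pred[n] t)))

module _ {K B : ℕ} where

  remQuot-injective : Injective _≡_ _≡_ (remQuot {K} B)
  remQuot-injective {p} {p′} e =
    trans (sym (combine-remQuot {K} B p)) (trans (cong (uncurry combine) e) (combine-remQuot {K} B p′))

  product : Array3 K → Array3 B → Array3 (K * B)
  product L₁ L₂ p q r = combine (L₁ (quo p) (quo q) (quo r)) (L₂ (rem p) (rem q) (rem r))
    where
    quo = proj₁ ∘ remQuot {K} B
    rem = proj₂ ∘ remQuot {K} B

  module _ {L₁ : Array3 K} {L₂ : Array3 B} where

    product-latin : IsLatinCube K L₁ → IsLatinCube B L₂ → IsLatinCube (K * B) (product L₁ L₂)
    product-latin ℓ₁ ℓ₂ = injective-lines⇒latin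
      (λ _ _ e → remQuot-injective (×-≡,≡→≡ (latin₁ ℓ₁ _ _ (proj₁ (split e)) , latin₁ ℓ₂ _ _ (proj₂ (split e)))))
      (λ _ _ e → remQuot-injective (×-≡,≡→≡ (latin₂ ℓ₁ _ _ (proj₁ (split e)) , latin₂ ℓ₂ _ _ (proj₂ (split e)))))
      (λ _ _ e → remQuot-injective (×-≡,≡→≡ (latin₃ ℓ₁ _ _ (proj₁ (split e)) , latin₃ ℓ₂ _ _ (proj₂ (split e)))))
      where
      split : ∀ {i k : Fin K} {j l : Fin B} → combine i j ≡ combine k l → i ≡ k × j ≡ l
      split = combine-injective _ _ _ _

    cell-subcube : IsLatinCube B L₂ → (x y z : Fin K) → Subcube (product L₁ L₂) B
    cell-subcube ℓ₂ x y z = record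
      { rows = combine x ; cols = combine y ; files = combine z ; symbols = combine (L₁ x y z)
      ; rows-inj = combine-injectiveʳ x _ x _
      ; cols-inj = combine-injectiveʳ y _ y _
      ; files-inj = combine-injectiveʳ z _ z _
      ; symbols-inj = combine-injectiveʳ (L₁ x y z) _ (L₁ x y z) _
      ; sub = L₂
      ; sub-latin = ℓ₂
      ; sub-agrees = agrees }
      where
      agrees : ∀ i j k → product L₁ L₂ (combine x i) (combine y j) (combine z k) ≡ combine (L₁ x y z) (L₂ i j k)
      agrees i j k = cong₂ (λ (x′ , i′) ((y′ , j′) , (z′ , k′)) → combine (L₁ x′ y′ z′) (L₂ i′ j′ k′))
        (remQuot-combine x i) (cong₂ _,_ (remQuot-combine y j) (remQuot-combine z k))

    cell-subcubes-disjoint : (ℓ₂ : IsLatinCube B L₂) → ∀ {x y z x′ y′ z′} →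
      x ≢ x′ → y ≢ y′ → z ≢ z′ → L₁ x y z ≢ L₁ x′ y′ z′ →
      Disjoint (cell-subcube ℓ₂ x y z) (cell-subcube ℓ₂ x′ y′ z′)
    cell-subcubes-disjoint _ x≢x′ y≢y′ z≢z′ s≢s′ =
      (λ _ _ → x≢x′ ∘ combine-injectiveˡ _ _ _ _) ,
      (λ _ _ → y≢y′ ∘ combine-injectiveˡ _ _ _ _) ,
      (λ _ _ → z≢z′ ∘ combine-injectiveˡ _ _ _ _) ,
      (λ _ _ → s≢s′ ∘ combine-injectiveˡ _ _ _ _)

cyclic-product-subcubes : ∀ k {B} {L₂ : Array3 B} → IsLatinCube B L₂ →
  Σ (Fin (suc k) → Subcube (product (cyclic k) L₂) B) λ T → ∀ t u → t ≢ u → Disjoint (T t) (T u)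
cyclic-product-subcubes k ℓ₂ =
  (λ t → cell-subcube {L₁ = cyclic k} ℓ₂ t t (opposite t)) ,
  (λ t u t≢u → cell-subcubes-disjoint {L₁ = cyclic k} ℓ₂ t≢u t≢u (t≢u ∘ opposite-injective)
                 (t≢u ∘ cyclic-diagonal-injective k))

module Substitution {L : Array3 N} (L-latin : IsLatinCube N L) (S : Subcube L m)
                    {Q : Array3 m} (Q-latin : IsLatinCube m Q) where

  open Subcube S using ()
    renaming (rows to R; cols to C; files to F; symbols to Y; symbols-inj to Y-inj)

  Inside : Fin N → Fin N → Fin N → Set
  Inside i j l = (∃ λ r → R r ≡ i) × (∃ λ s → C s ≡ j) × (∃ λ f → F f ≡ l)

  inside? : ∀ i j l → Dec (Inside i j l)
  inside? i j l = preimage? R i ×-dec preimage? C j ×-dec preimage? F l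

  patched : Array3 N
  patched i j l with inside? i j l
  ... | yes ((r , _) , (s , _) , (f , _)) = Y (Q r s f)
  ... | no _ = L i j l

  patched-inside : ∀ r s f → patched (R r) (C s) (F f) ≡ Y (Q r s f)
  patched-inside r s f with inside? (R r) (C s) (F f)
  ... | yes ((r′ , e) , (s′ , e′) , (f′ , e″))
    rewrite rows-inj S e | cols-inj S e′ | files-inj S e″ = refl
  ... | no outside = ⊥-elim (outside ((r , refl) , (s , refl) , (f , refl)))

  patched-outside : ∀ {i j l} → ¬ Inside i j l → patched i j l ≡ L i j l
  patched-outside {i} {j} {l} outside with inside? i j l
  ... | yes inside = ⊥-elim (outside inside)
  ... | no _ = refl

  private
    inside-injective : ∀ {r s f r′ s′ f′} →
      patched (R r) (C s) (F f) ≡ patched (R r′) (C s′) (F f′) → Q r s f ≡ Q r′ s′ f′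
    inside-injective e = Y-inj (trans (sym (patched-inside _ _ _)) (trans e (patched-inside _ _ _)))

    absorbed : ∀ {r s f r₀ s₀ f₀} → sub S r₀ s₀ f₀ ≡ Q r s f →
      patched (R r) (C s) (F f) ≡ L (R r₀) (C s₀) (F f₀)
    absorbed e = trans (patched-inside _ _ _) (trans (cong Y (sym e)) (sym (sub-agrees S _ _ _)))

  -- On a line through the subcube, the new values are those of a line of Q,
  -- which are also those of the matching line of sub S (both are permutations
  -- of the subcube's symbols), i.e. values L already takes on that line.
  patched-latin : IsLatinCube N patched
  patched-latin = injective-lines⇒latin
    (λ j l → along₁ (preimage? C j ×-dec preimage? F l))
    (λ i l → along₂ (preimage? R i ×-dec preimage? F l))
    (λ i j → along₃ (preimage? R i ×-dec preimage? C j))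
    where
    along₁ : ∀ {j l} → Dec ((∃ λ s → C s ≡ j) × (∃ λ f → F f ≡ l)) →
      Injective _≡_ _≡_ (λ i → patched i j l)
    along₁ (no off) = injective-resp-≗ (λ _ → patched-outside (off ∘ proj₂)) (latin₁ L-latin _ _)
    along₁ (yes ((s , refl) , (f , refl))) =
      patch-injective R (latin₁ L-latin _ _) (latin₁ Q-latin s f ∘ inside-injective)
        (λ r → map₂ absorbed (injective⇒surjective (latin₁ (sub-latin S) s f) (Q r s f)))
        (λ _ outside → patched-outside (outside ∘ proj₁))

    along₂ : ∀ {i l} → Dec ((∃ λ r → R r ≡ i) × (∃ λ f → F f ≡ l)) →
      Injective _≡_ _≡_ (λ j → patched i j l)
    along₂ (no off) = injective-resp-≗ (λ _ → patched-outside λ (r , _ , f) → off (r , f)) (latin₂ L-latin _ _)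
    along₂ (yes ((r , refl) , (f , refl))) =
      patch-injective C (latin₂ L-latin _ _) (latin₂ Q-latin r f ∘ inside-injective)
        (λ s → map₂ absorbed (injective⇒surjective (latin₂ (sub-latin S) r f) (Q r s f)))
        (λ _ outside → patched-outside (outside ∘ proj₁ ∘ proj₂))

    along₃ : ∀ {i j} → Dec ((∃ λ r → R r ≡ i) × (∃ λ s → C s ≡ j)) →
      Injective _≡_ _≡_ (λ l → patched i j l)
    along₃ (no off) = injective-resp-≗ (λ _ → patched-outside λ (r , s , _) → off (r , s)) (latin₃ L-latin _ _)
    along₃ (yes ((r , refl) , (s , refl))) =
      patch-injective F (latin₃ L-latin _ _) (latin₃ Q-latin r s ∘ inside-injective)
        (λ f → map₂ absorbed (injective⇒surjective (latin₃ (sub-latin S) r s) (Q r s f)))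
        (λ _ outside → patched-outside (outside ∘ proj₂ ∘ proj₂))

  retain : (X : Subcube L n) → Disjoint X S → Subcube patched n
  retain X (rows-apart , _) = record
    { rows = rows X ; cols = cols X ; files = files X ; symbols = symbols X
    ; rows-inj = rows-inj X ; cols-inj = cols-inj X ; files-inj = files-inj X
    ; symbols-inj = symbols-inj X
    ; sub = sub X ; sub-latin = sub-latin X
    ; sub-agrees = λ i j k →
        trans (patched-outside λ ((r , e) , _) → rows-apart i r (sym e)) (sub-agrees X i j k) }

  embed : Subcube Q n → Subcube patched n
  embed T = record
    { rows = R ∘ rows T ; cols = C ∘ cols T ; files = F ∘ files T ; symbols = Y ∘ symbols T
    ; rows-inj = ∘-injective _≡_ _≡_ _≡_ (rows-inj T) (rows-inj S)
    ; cols-inj = ∘-injective _≡_ _≡_ _≡_ (cols-inj T) (cols-inj S)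
    ; files-inj = ∘-injective _≡_ _≡_ _≡_ (files-inj T) (files-inj S)
    ; symbols-inj = ∘-injective _≡_ _≡_ _≡_ (symbols-inj T) Y-inj
    ; sub = sub T ; sub-latin = sub-latin T
    ; sub-agrees = λ i j k → trans (patched-inside _ _ _) (cong Y (sub-agrees T i j k)) }

  embed-disjoint : {T : Subcube Q n} {T′ : Subcube Q p} → Disjoint T T′ → Disjoint (embed T) (embed T′)
  embed-disjoint (r , c , f , s) =
    (λ x y → r x y ∘ rows-inj S) , (λ x y → c x y ∘ cols-inj S) ,
    (λ x y → f x y ∘ files-inj S) , (λ x y → s x y ∘ Y-inj)

  retain-embed-disjoint : (X : Subcube L n) (D : Disjoint X S) (T : Subcube Q p) →
    Disjoint (retain X D) (embed T)
  retain-embed-disjoint _ (r , c , f , s) T =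
    (λ x y → r x (rows T y)) , (λ x y → c x (cols T y)) ,
    (λ x y → f x (files T y)) , (λ x y → s x (symbols T y))

module Spread (F : ℕ → Set) {b : ℕ} where

  spread : ∀ {K} → (Fin K → F b) → (t : Fin (length (replicate K b))) → F (lookup (replicate K b) t)
  spread {suc K} T zero = T zero
  spread {suc K} T (suc t) = spread (T ∘ suc) t

  spread-∀ : (P : ∀ {m} → F m → Set) → ∀ {K} (T : Fin K → F b) →
    (∀ k → P (T k)) → ∀ t → P (spread T t)
  spread-∀ P {suc K} T all zero = all zero
  spread-∀ P {suc K} T all (suc t) = spread-∀ P (T ∘ suc) (all ∘ suc) t

  spread-pairwise : (Rel : ∀ {m m′} → F m → F m′ → Set) → ∀ {K} (T : Fin K → F b) →
    (∀ k l → k ≢ l → Rel (T k) (T l)) → ∀ t u → t ≢ u → Rel (spread T t) (spread T u)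
  spread-pairwise Rel {suc K} T rel zero zero t≢u = ⊥-elim (t≢u refl)
  spread-pairwise Rel {suc K} T rel zero (suc u) _ =
    spread-∀ (Rel (T zero)) (T ∘ suc) (λ l → rel zero (suc l) λ ()) u
  spread-pairwise Rel {suc K} T rel (suc t) zero _ =
    spread-∀ (λ X → Rel X (T zero)) (T ∘ suc) (λ k → rel (suc k) zero λ ()) t
  spread-pairwise Rel {suc K} T rel (suc t) (suc u) t≢u =
    spread-pairwise Rel (T ∘ suc) (λ k l k≢l → rel (suc k) (suc l) (k≢l ∘ suc-injective)) t u
      (t≢u ∘ cong suc)

sum-replicate : ∀ K b → sum (replicate K b) ≡ K * b
sum-replicate zero b = refl
sum-replicate (suc K) b = cong (b +_) (sum-replicate K b)

LC-from-subcubes : ∀ {a K b} {L : Array3 N} → N ≡ sum (a ∷ a ∷ replicate K b) → IsLatinCube N L →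
  (S₀ S₁ : Subcube L a) (T : Fin K → Subcube L b) →
  Disjoint S₀ S₁ → (∀ t → Disjoint S₀ (T t)) → (∀ t → Disjoint S₁ (T t)) →
  (∀ t u → t ≢ u → Disjoint (T t) (T u)) →
  LC (a ∷ a ∷ replicate K b)
LC-from-subcubes {a = a} {K} {b} {L} refl L-latin S₀ S₁ T apart₀₁ apart₀ apart₁ apart =
  L , L-latin , family , disjoint
  where
  open Spread (Subcube L)

  family : ∀ t → Subcube L (lookup (a ∷ a ∷ replicate K b) t)
  family zero = S₀
  family (suc zero) = S₁
  family (suc (suc t)) = spread T t

  disjoint : ∀ t u → t ≢ u → Disjoint (family t) (family u)
  disjoint zero zero t≢u = ⊥-elim (t≢u refl)
  disjoint zero (suc zero) _ = apart₀₁
  disjoint zero (suc (suc u)) _ = spread-∀ (Disjoint S₀) T apart₀ u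
  disjoint (suc zero) zero _ = Disjoint-sym S₀ S₁ apart₀₁
  disjoint (suc zero) (suc zero) t≢u = ⊥-elim (t≢u refl)
  disjoint (suc zero) (suc (suc u)) _ = spread-∀ (Disjoint S₁) T apart₁ u
  disjoint (suc (suc t)) zero _ = Disjoint-sym S₀ (spread T t) (spread-∀ (Disjoint S₀) T apart₀ t)
  disjoint (suc (suc t)) (suc zero) _ = Disjoint-sym S₁ (spread T t) (spread-∀ (Disjoint S₁) T apart₁ t)
  disjoint (suc (suc t)) (suc (suc u)) t≢u =
    spread-pairwise Disjoint T apart t u (t≢u ∘ cong (λ w → suc (suc w)))


lemma19 : (∀ (a c : ℕ) → 1 ≤ a → 1 ≤ c → c < a → a ≤ 2 * c → LC (a ∷ a ∷ c ∷ [])) →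
    ∀ (n a b : ℕ) → 4 ≤ n → 1 ≤ a → 1 ≤ b →
    (n ∸ 2) * b < a → a ≤ 2 * ((n ∸ 2) * b) →
    LC (a ∷ a ∷ replicate (n ∸ 2) b)
lemma19 LC-a²c¹ (suc (suc (suc (suc k)))) a (suc b) (s≤s (s≤s (s≤s (s≤s _)))) 1≤a (s≤s _) c<a a≤2c
  with LC-a²c¹ a (suc (suc k) * suc b) 1≤a (s≤s z≤n) c<a a≤2c
     | cyclic-product-subcubes (suc k) (cyclic-latin b)
... | L , L-latin , S , S-apart | T , T-apart =
  LC-from-subcubes order patched-latin
    (retain (S zero) S₀-apart) (retain (S (suc zero)) S₁-apart) (λ t → embed (T t))
    (S-apart zero (suc zero) λ ())
    (λ t → retain-embed-disjoint (S zero) S₀-apart (T t))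
    (λ t → retain-embed-disjoint (S (suc zero)) S₁-apart (T t))
    (λ t u t≢u → embed-disjoint {T = T t} {T u} (T-apart t u t≢u))
  where
  open Substitution L-latin (S (suc (suc zero))) (product-latin (cyclic-latin (suc k)) (cyclic-latin b))

  S₀-apart : Disjoint (S zero) (S (suc (suc zero)))
  S₀-apart = S-apart zero (suc (suc zero)) λ ()

  S₁-apart : Disjoint (S (suc zero)) (S (suc (suc zero)))
  S₁-apart = S-apart (suc zero) (suc (suc zero)) λ ()

  order : a + (a + (suc (suc k) * suc b + 0)) ≡ a + (a + sum (replicate (suc (suc k)) (suc b)))
  order = cong (λ w → a + (a + w)) (trans (ℕ.+-identityʳ _) (sym (sum-replicate (suc (suc k)) (suc b))))
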